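{- Let $\mathcal S=(\Sigma,\mathbf v,\Phi,\iota,\tau,AP)$ be a system specification and let $\mathcal S_0=(\Sigma_0,\mathbf v_0,\Phi_0,\iota_0,\tau_0,AP_0)$ be a sub-system specification of $\mathcal S$. Then the map $\pi_{\mathcal S_0}$ which sends a state $\mathbf v_{\mathcal M,\mathcal I}$ of $T^{\mathcal S}$ to the state $(\mathbf v_0)_{\mathcal M_{|\Sigma_0},\mathcal I_{|\mathbf v_0}}$ of $T^{\mathcal S_0}$ is a simulation of $T^{\mathcal S}$ by $T^{\mathcal S_0}$.
   Context: Work in (classical, Church-style) simple type theory. A constrained signature $\Sigma$ consists of primitive sorts (always including the sort $\Omega$ of truth values $\{\mathtt{tt},\mathtt{ff}\}$ with its Boolean operations), primitive sorted function symbols, and a class $\mathcal C_\Sigma$ (assumed to be a set) of $\Sigma$-structures called the models of $\Sigma$ (some sorts, such as the integers $\mathbb Z$ with linear arithmetic, or $\Omega$, have a fixed standard interpretation in every model). Types are built from primitive sorts by function types; terms are built from variables and function symbols by $\lambda$-abstraction and application; formulae are terms of type $\Omega$. For a tuple of variables $\mathbf v$, a $\Sigma$-interpretation of $\mathbf v$ in $\mathcal M\in\mathcal C_\Sigma$ assigns to each variable an element of its type; $\mathbf v_{\mathcal M,\mathcal I}$ denotes the resulting tuple of values. A formula $\phi(\mathbf v)$ is valid ($\models_\Sigma\phi$) if it is true in all $\mathcal M\in\mathcal C_\Sigma$ under all interpretations; $\phi\models_\Sigma\psi$ means $\phi\to\psi$ is valid. A transition system is $\mathcal T=(W,W_0,R,AP,V)$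 with state set $W$, initial states $W_0\subseteq W$, transition relation $R\subseteq W\times W$, set $AP$ of atomic propositions and labeling $V$ assigning to each state the set of propositions true in it. A relation $\rho\subseteq W\times W'$ is a simulation of $\mathcal T$ by $\mathcal T'=(W',W'_0,R',AP,V')$ (same $AP$) if: (i) every $w\in W$ has some $w'$ with $w\rho w'$; (ii) $w\rho w'$ and $w\in W_0$ imply $w'\in W'_0$; (iii) if $w\rho w'$ and $wRv$ then there is $v'$ with $w'R'v'$ and $v\rho v'$; (iv) $w\rho w'$ implies $V(w)=V'(w')$. A system specification is $\mathcal S=(\Sigma,\mathbf v,\Phi,\iota,\tau,AP)$ where $\Sigma$ is a constrained signature, $\mathbf v$ a tuple of variables, $\Phi,\iota$ are $\mathbf v$-formulae, $AP$ a set of $\mathbf v$-formulae, $\tau$ a $(\mathbf v,\mathbf v')$-formula ($\mathbf v'$ a renamed copy of $\mathbf v$), with $\iota(\mathbf v)\models_\Sigma\Phi(\mathbf v)$ and $\Phi(\mathbf v)\wedge\tau(\mathbf v,\mathbf v')\models_\Sigma\Phi(\mathbf v')$. Its transition system $T^{\mathcal S}$ has as states the tuples $\mathbf v_{\mathcal M,\mathcal I}$ satisfying $\Phi$ (over all $\mathcal M\in\mathcal C_\Sigma$ and interpretations $\mathcal I$), as initial states those satisfying $\iota$, as transitions the pairs $\mathbf v_{\mathcal M,\mathcal I},\mathbf v'_{\mathcal M,\mathcal I'}$ (same model $\mathcal M$) satisfying $\tau(\mathbf v,\mathbf v')$, atomic propositions $AP$, and labels given by which $\psi\in AP$ the state satisfies.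 A subsignature $\Sigma_0$ of $\Sigma$ is obtained by dropping some symbols, with $\mathcal C_{\Sigma_0}$ the class of restrictions $\mathcal M_{|\Sigma_0}$ of models $\mathcal M\in\mathcal C_\Sigma$. A sub-system specification of $\mathcal S$ is a system specification $\mathcal S_0=(\Sigma_0,\mathbf v_0,\Phi_0,\iota_0,\tau_0,AP_0)$ with $\Sigma_0$ a subsignature of $\Sigma$, $\mathbf v_0\subseteq\mathbf v$, $AP_0=AP$, and $\Phi(\mathbf v)\models_\Sigma\Phi_0(\mathbf v_0)$, $\iota(\mathbf v)\models_\Sigma\iota_0(\mathbf v_0)$, $\Phi(\mathbf v)\wedge\tau(\mathbf v,\mathbf v')\models_\Sigma\tau_0(\mathbf v_0,\mathbf v_0')$. -}

module Defs where

open import Data.Bool using (Bool; true; false; _∧_)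
open import Data.List using (List)
open import Data.List.Membership.Propositional using (_∈_)
open import Data.List.Relation.Unary.All as All using (All)
open import Data.Product using (Σ; _,_; _×_; Σ-syntax)
open import Relation.Binary.PropositionalEquality using (_≡_; refl; cong₂; subst)
open import Function using (_∘_)

infixr 5 _⇒_
data Ty (S : Set) : Set where
  Ω   : Ty S
  ι   : S → Ty S
  _⇒_ : Ty S → Ty S → Ty S

⟦_⟧ : {S : Set} → Ty S → (S → Set) → Set
⟦ Ω ⟧     I = Bool
⟦ ι s ⟧   I = I s
⟦ A ⇒ B ⟧ I = ⟦ A ⟧ I → ⟦ B ⟧ I

mapTy : {S S' : Set} → (S → S') → Ty S → Ty S'
mapTy f Ω       = Ω
mapTy f (ι s)   = ι (f s)
mapTy f (A ⇒ B) = mapTy f A ⇒ mapTy f B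

record Signature : Set₁ where
  field
    Sort : Set
    Fun  : Ty Sort → Set
open Signature public

record Structure (Sg : Signature) : Set₁ where
  constructor mkStructure
  field
    sortI : Sort Sg → Set
    funI  : ∀ {T} → Fun Sg T → ⟦ T ⟧ sortI
open Structure public

record ConstrainedSignature : Set₂ where
  field
    sig     : Signature
    IsModel : Structure sig → Set₁
open ConstrainedSignature public

Ctx : Signature → Set
Ctx Sg = List (Ty (Sort Sg))

Env : {Sg : Signature} → Structure Sg → Ctx Sg → Set
Env M Γ = All (λ T → ⟦ T ⟧ (sortI M)) Γ

-- v-formulas and (v,v')-formulas, identified with their denotation
Formula : (C : ConstrainedSignature) → Ctx (sig C) → Set₁
Formula C Γ = (M : Structure (sig C)) → Env M Γ → Bool

Formula₂ : (C : ConstrainedSignature) → Ctx (sig C) → Set₁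
Formula₂ C Γ = (M : Structure (sig C)) → Env M Γ → Env M Γ → Bool

Entails : (C : ConstrainedSignature) {Γ : Ctx (sig C)} → Formula C Γ → Formula C Γ → Set₁
Entails C φ ψ = ∀ (M : Structure (sig C)) → IsModel C M → ∀ e → φ M e ≡ true → ψ M e ≡ true

Entails₂ : (C : ConstrainedSignature) {Γ : Ctx (sig C)} → Formula₂ C Γ → Formula₂ C Γ → Set₁
Entails₂ C φ ψ = ∀ (M : Structure (sig C)) → IsModel C M → ∀ e e' → φ M e e' ≡ true → ψ M e e' ≡ true

syntax Entails C φ ψ = φ ⊨[ C ] ψ
syntax Entails₂ C φ ψ = φ ⊨₂[ C ] ψ

_∧τ_ : ∀ {C Γ} → Formula C Γ → Formula₂ C Γ → Formula₂ C Γ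
(Φ ∧τ τ) M e e' = Φ M e ∧ τ M e e'

primed : ∀ {C Γ} → Formula C Γ → Formula₂ C Γ
primed Φ M e e' = Φ M e'

record TransitionSystem (AP : Set) : Set₂ where
  field
    W  : Set₁
    W₀ : W → Set
    R  : W → W → Set₁
    V  : W → AP → Bool          -- V w p = true  iff  p ∈ V(w)
open TransitionSystem public

record IsSimulation {AP : Set} (T T' : TransitionSystem AP)
                    (ρ : W T → W T' → Set₁) : Set₁ where
  field
    total   : ∀ w → Σ[ w' ∈ W T' ] ρ w w'
    initial : ∀ {w w'} → ρ w w' → W₀ T w → W₀ T' w'
    step    : ∀ {w w' v} → ρ w w' → R T w v → Σ[ v' ∈ W T' ] (R T' w' v' × ρ v v')
    label   : ∀ {w w'} → ρ w w' → ∀ p → V T w p ≡ V T' w' p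

record SystemSpec (C : ConstrainedSignature) (AP : Set) : Set₁ where
  field
    vars : Ctx (sig C)
    Φ    : Formula C vars
    ini  : Formula C vars
    τ    : Formula₂ C vars
    ap   : AP → Formula C vars
    ini⊨Φ  : ini ⊨[ C ] Φ
    Φτ⊨Φ'  : (_∧τ_ {C} Φ τ) ⊨₂[ C ] primed {C} Φ
open SystemSpec public

module _ {C : ConstrainedSignature} {AP : Set} (S : SystemSpec C AP) where

  record State : Set₁ where
    constructor state
    field
      model   : Structure (sig C)
      isModel : IsModel C model
      env     : Env model (vars S)
      inv     : Φ S model env ≡ true
  open State public

  data Step : State → State → Set₁ where
    step : ∀ {M m m' e e' i i'} → τ S M e e' ≡ true →
           Step (state M m e i) (state M m' e' i')

  TS : TransitionSystem AP
  TS = record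
    { W  = State
    ; W₀ = λ w → ini S (model w) (env w) ≡ true
    ; R  = Step
    ; V  = λ w p → ap S p (model w) (env w)
    }

mapTy-⟦⟧ : {S S' : Set} (σ : S → S') (I : S' → Set) (T : Ty S) →
           ⟦ mapTy σ T ⟧ I ≡ ⟦ T ⟧ (I ∘ σ)
mapTy-⟦⟧ σ I Ω       = refl
mapTy-⟦⟧ σ I (ι s)   = refl
mapTy-⟦⟧ σ I (A ⇒ B) = cong₂ (λ X Y → X → Y) (mapTy-⟦⟧ σ I A) (mapTy-⟦⟧ σ I B)

record Subsignature (Sg : Signature) : Set₁ where
  field
    Sg₀    : Signature
    σ      : Sort Sg₀ → Sort Sg
    σ-inj  : ∀ {s t} → σ s ≡ σ t → s ≡ t
    φ      : ∀ {T} → Fun Sg₀ T → Fun Sg (mapTy σ T)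
    φ-inj  : ∀ {T} {f g : Fun Sg₀ T} → φ f ≡ φ g → f ≡ g

  coe : (I : Sort Sg → Set) (T : Ty (Sort Sg₀)) → ⟦ mapTy σ T ⟧ I → ⟦ T ⟧ (I ∘ σ)
  coe I T = subst (λ X → X) (mapTy-⟦⟧ σ I T)

  restrict : Structure Sg → Structure Sg₀
  restrict M = mkStructure (sortI M ∘ σ) (λ {T} f → coe (sortI M) T (funI M (φ f)))
open Subsignature public

reductCSig : (C : ConstrainedSignature) → Subsignature (sig C) → ConstrainedSignature
reductCSig C sub = record
  { sig     = Sg₀ sub
  ; IsModel = λ M₀ → Σ[ M ∈ Structure (sig C) ] (IsModel C M × restrict sub M ≡ M₀)
  }

module _ (C : ConstrainedSignature) (sub : Subsignature (sig C))
         (Γ : Ctx (sig C)) (Γ₀ : Ctx (Sg₀ sub))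
         (vemb : ∀ {T} → T ∈ Γ₀ → mapTy (σ sub) T ∈ Γ) where

  restrictEnv : (M : Structure (sig C)) → Env M Γ → Env (restrict sub M) Γ₀
  restrictEnv M e = All.tabulate (λ {T} x → coe sub (sortI M) T (All.lookup e (vemb x)))

  view : Formula (reductCSig C sub) Γ₀ → Formula C Γ
  view F M e = F (restrict sub M) (restrictEnv M e)

  view₂ : Formula₂ (reductCSig C sub) Γ₀ → Formula₂ C Γ
  view₂ F M e e' = F (restrict sub M) (restrictEnv M e) (restrictEnv M e')

record SubSpec {C : ConstrainedSignature} {AP : Set} (S : SystemSpec C AP) : Set₂ where
  field
    sub      : Subsignature (sig C)
    S₀       : SystemSpec (reductCSig C sub) AP       -- AP₀ indexed by the same AP
    vemb     : ∀ {T} → T ∈ vars S₀ → mapTy (σ sub) T ∈ vars S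
    vemb-inj : ∀ {T} {x y : T ∈ vars S₀} → vemb x ≡ vemb y → x ≡ y
    AP₀≡AP   : ∀ p → ap S p ≡ view C sub (vars S) (vars S₀) vemb (ap S₀ p)
    Φ⊨Φ₀     : Φ S ⊨[ C ] view C sub (vars S) (vars S₀) vemb (Φ S₀)
    ι⊨ι₀     : ini S ⊨[ C ] view C sub (vars S) (vars S₀) vemb (ini S₀)
    Φτ⊨τ₀    : (_∧τ_ {C} (Φ S) (τ S)) ⊨₂[ C ] view₂ C sub (vars S) (vars S₀) vemb (τ S₀)

  π : State S → State S₀
  π (state M m e i) =
    state (restrict sub M) (M , m , refl) (restrictEnv C sub (vars S) (vars S₀) vemb M e) (Φ⊨Φ₀ M m e i)
open SubSpec public

-- π_{S₀} only restricts the model and the interpretation, so each clause of a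
-- simulation is one of the entailments that make S₀ a sub-system specification
-- (Φ ⊨ Φ₀ for states, ι ⊨ ι₀ for initial states, Φ ∧ τ ⊨ τ₀ for steps,
-- AP₀ = AP for labels), read at the model of the given state.
module Submission where

open import Defs
open import Data.Bool using (Bool; true; _∧_)
open import Data.Product using (_,_)
open import Relation.Binary.PropositionalEquality using (_≡_; refl; cong-app)

∧-intro : ∀ {a b : Bool} → a ≡ true → b ≡ true → a ∧ b ≡ true
∧-intro refl refl = refl

module _ {C : ConstrainedSignature} {AP : Set} {S : SystemSpec C AP} (S₀ : SubSpec S) where

  private
    T₀ = TS (SubSpec.S₀ S₀)

  π-initial : ∀ w → W₀ (TS S) w → W₀ T₀ (π S₀ w)
  π-initial (state M m e _) = ι⊨ι₀ S₀ M m e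

  π-step : ∀ {w v} → Step S w v → Step (SubSpec.S₀ S₀) (π S₀ w) (π S₀ v)
  π-step {state M m e i} {state .M _ e' _} (step t) =
    step (Φτ⊨τ₀ S₀ M m e e' (∧-intro i t))

  π-label : ∀ w p → V (TS S) w p ≡ V T₀ (π S₀ w) p
  π-label (state M _ e _) p = cong-app (cong-app (AP₀≡AP S₀ p) M) e

proposition1 : {C : ConstrainedSignature} {AP : Set} (S : SystemSpec C AP) (S₀ : SubSpec S) →
    IsSimulation (TS S) (TS (SubSpec.S₀ S₀)) (λ w w' → π S₀ w ≡ w')
proposition1 S S₀ = record
  { total   = λ w → π S₀ w , refl
  ; initial = λ { {w} refl → π-initial S₀ w }
  ; step    = λ { {v = v} refl R → π S₀ v , π-step S₀ R , refl }
  ; label   = λ { {w} refl → π-label S₀ w }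
  }
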